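{- Let $D(n)=\max_{1\le i\le n}d(i)$ ($d(i)$ the number of divisors of $i$), $\omega(n)=D(n)^{100}$, $p=p(n)\le n^{ -1/9}\omega(n)^{ -1}$ and $S\sim[n]_p$. Then asymptotically almost surely there is no forbidden configuration $M$ in $S\cap(n^{1/9},n]$ whose effective size $s$ and repetition number $r$ satisfy $s+r\ge 9$.
   Context: $[n]_p$ is the random subset of $[n]$ containing each integer independently with probability $p$; a.a.s. means with probability tending to $1$. For integer sets, $X\cdot Y=\{xy:x\in X,y\in Y\}$, similarly for triple products. A tuple $M=(a,b,c,d,e,f,x,y,z,u,v,w)$ is a forbidden configuration in a set $T$ if: (i) $c=ab=def$, $a=xyz$ and $b=uvw$; (ii) $a,b,c,d,e,x,y,u,v\in T$ and $f,z,w\in T\cup\{1\}$; (iii) $a$ and $b$ are different from each of $c,d,e,f,x,y,z,u,v,w$; (iv) with $A=\{x,y,z,d,e,f,u,v,w\}\setminus\{1\}$, $A$ is disjoint from $A\cdot A$ and from $A\cdot A\cdot A$. The effective size $s$ of $M$ is the number of distinct elements different from $1$ among its entries. Its repetition number is $r=r_1-r_2$, where $r_1$ is the number of entries among $x,y,z,u,v,w$ (counted with position) that are not $1$, and $r_2=|\{x,y,z,u,v,w\}\setminus\{1\}|$.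
   Formalization: The probability $p=p(n)$ of the random set takes only rational values. -}

module Defs where

open import Data.Nat as ℕ using (ℕ; zero; suc; _≤_; _<_; _∸_)
import Data.Nat.Properties as ℕP
open import Data.Nat.Divisibility using (_∣?_)
open import Data.Bool using (Bool; true; false)
open import Data.Fin using (Fin; toℕ)
open import Data.Vec using (Vec; []; _∷_; lookup)
open import Data.List using (List; []; _∷_; _++_; map; filter; length; deduplicate; upTo; foldr)
open import Data.Product using (Σ; ∃; _×_; _,_)
open import Data.Sum using (_⊎_)
open import Relation.Nullary using (¬_; Dec; yes; no; ¬?)
open import Relation.Unary using (Pred; Decidable)
open import Relation.Binary.PropositionalEquality using (_≡_; _≢_)
open import Data.Rational as ℚ using (ℚ; 0ℚ; 1ℚ)
import Data.Integer as ℤ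
import Level

d : ℕ → ℕ
d i = length (filter (λ k → k ∣? i) (map suc (upTo i)))

D : ℕ → ℕ
D n = foldr ℕ._⊔_ 0 (map d (map suc (upTo n)))

ω : ℕ → ℕ
ω n = D n ℕ.^ 100

-- Random subsets of [n] = {1,…,n}: a subset is a Vec Bool n,
-- position i (a Fin n) standing for the integer toℕ i + 1.

_∈ₛ_ : {n : ℕ} → ℕ → Vec Bool n → Set
_∈ₛ_ {n} x S = Σ (Fin n) λ i → (suc (toℕ i) ≡ x) × (lookup S i ≡ true)

-- membership in S ∩ (n^{1/9}, n] :  x ∈ S and x > n^{1/9}, i.e. x^9 > n
_∈T_ : {n : ℕ} → ℕ → Vec Bool n → Set
_∈T_ {n} x S = (x ∈ₛ S) × (n < x ℕ.^ 9)

_∈T₁_ : {n : ℕ} → ℕ → Vec Bool n → Set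
x ∈T₁ S = (x ∈T S) ⊎ (x ≡ 1)

record Config : Set where
  constructor config
  field
    a b c d' e f x y z u v w : ℕ

open Config public

-- list of elements of A = {x,y,z,d,e,f,u,v,w} \ {1} (possibly with repetitions)
nonOne : List ℕ → List ℕ
nonOne = filter (λ t → ¬? (t ℕ.≟ 1))

Alist : Config → List ℕ
Alist M = nonOne (x M ∷ y M ∷ z M ∷ d' M ∷ e M ∷ f M ∷ u M ∷ v M ∷ w M ∷ [])

open import Data.List.Membership.Propositional using (_∈_)

record IsForbidden {n : ℕ} (T : Vec Bool n) (M : Config) : Set where
  field
    c≡ab   : c M ≡ a M ℕ.* b M
    c≡def  : c M ≡ d' M ℕ.* e M ℕ.* f M
    a≡xyz  : a M ≡ x M ℕ.* y M ℕ.* z M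
    b≡uvw  : b M ≡ u M ℕ.* v M ℕ.* w M
    a∈ : a M ∈T T
    b∈ : b M ∈T T
    c∈ : c M ∈T T
    d∈ : d' M ∈T T
    e∈ : e M ∈T T
    x∈ : x M ∈T T
    y∈ : y M ∈T T
    u∈ : u M ∈T T
    v∈ : v M ∈T T
    f∈ : f M ∈T₁ T
    z∈ : z M ∈T₁ T
    w∈ : w M ∈T₁ T
    a-distinct : ∀ t → t ∈ (c M ∷ d' M ∷ e M ∷ f M ∷ x M ∷ y M ∷ z M ∷ u M ∷ v M ∷ w M ∷ []) → a M ≢ t
    b-distinct : ∀ t → t ∈ (c M ∷ d' M ∷ e M ∷ f M ∷ x M ∷ y M ∷ z M ∷ u M ∷ v M ∷ w M ∷ []) → b M ≢ t
    A-disj₂ : ∀ α β γ → α ∈ Alist M → β ∈ Alist M → γ ∈ Alist M → α ≢ β ℕ.* γ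
    A-disj₃ : ∀ α β γ δ → α ∈ Alist M → β ∈ Alist M → γ ∈ Alist M → δ ∈ Alist M
              → α ≢ β ℕ.* γ ℕ.* δ

effSize : Config → ℕ
effSize M = length (deduplicate ℕ._≟_ (nonOne
  (a M ∷ b M ∷ c M ∷ d' M ∷ e M ∷ f M ∷ x M ∷ y M ∷ z M ∷ u M ∷ v M ∷ w M ∷ [])))

repNum : Config → ℕ
repNum M = length xs ∸ length (deduplicate ℕ._≟_ xs)
  where xs = nonOne (x M ∷ y M ∷ z M ∷ u M ∷ v M ∷ w M ∷ [])

NoBadConfig : (n : ℕ) → Pred (Vec Bool n) Level.zero
NoBadConfig n S = ¬ (Σ Config λ M → IsForbidden S M × (9 ≤ effSize M ℕ.+ repNum M))

allSubsets : (n : ℕ) → List (Vec Bool n)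
allSubsets zero = [] ∷ []
allSubsets (suc n) = map (true ∷_) (allSubsets n) ++ map (false ∷_) (allSubsets n)

weight : {n : ℕ} → ℚ → Vec Bool n → ℚ
weight p [] = 1ℚ
weight p (true ∷ S) = p ℚ.* weight p S
weight p (false ∷ S) = (1ℚ ℚ.- p) ℚ.* weight p S

Pr : (n : ℕ) (p : ℚ) (P : Pred (Vec Bool n) Level.zero) → Decidable P → ℚ
Pr n p P P? = foldr ℚ._+_ 0ℚ (map term (allSubsets n))
  where
    term : Vec Bool n → ℚ
    term S with P? S
    ... | yes _ = weight p S
    ... | no  _ = 0ℚ

_^ℚ_ : ℚ → ℕ → ℚ
q ^ℚ zero = 1ℚ
q ^ℚ suc k = q ℚ.* (q ^ℚ k)

-- p ≤ n^{-1/9} ω(n)^{-1}  (with p ≥ 0), written without roots: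
-- 0 ≤ p  and  n · (p · ω(n))^9 ≤ 1
ProbBound : ℕ → ℚ → Set
ProbBound n p = (0ℚ ℚ.≤ p) × (((ℤ.+ n ℚ./ 1) ℚ.* ((p ℚ.* (ℤ.+ (ω n) ℚ./ 1)) ^ℚ 9)) ℚ.≤ 1ℚ)

-- A first-moment bound.  A forbidden configuration M in S ∩ (n^{1/9}, n] with s + r ≥ 9 is
-- determined by its repetition number r ≤ 6, the product P of the distinct entries ≠ 1 among
-- x, y, z, u, v, w, these six entries as divisors of P, and d, e, f as divisors of c = xyzuvw ≤ n.
-- Every entry exceeds n^{1/9}, so P^9 n^r ≤ c^9 ≤ n^9, i.e. P ≤ n^{(9-r)/9}, and each divisor choice
-- has at most D(n) options.  The s ≥ 9 - r distinct entries of M all lie in S with probability at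
-- most p^{9-r}, so the expected number of such M is at most
--   7 n^{(9-r)/9} D(n)^9 p^{9-r} ≤ 7 D(n)^9 ω(n)^{-(9-r)} ≤ 7 / D(n)      (as n (p ω(n))^9 ≤ 1),
-- which tends to 0 because D(2^K) ≥ K + 1.

module Submission where

open import Defs
open import Data.Nat using (ℕ; _≥_)
open import Data.Rational using (ℚ; 0ℚ; 1ℚ; _<_; _≤_; _-_)
open import Data.Product using (Σ)
open import Relation.Unary using (Decidable)

open import Data.Nat as ℕ using (zero; suc)
open import Algebra.Bundles using (CommutativeRing)
open import Data.Bool using (true; false; if_then_else_)
open import Data.Bool.Properties using (T-≡)
open import Data.Fin using (Fin; toℕ)
import Data.Fin.Properties as Finₚ
open import Data.Fin.Subset as Subset using (Subset; ∣_∣; inside; outside)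
open import Data.Fin.Subset.Properties using (_⊆?_)
import Data.Integer as ℤ
import Data.Integer.Properties as ℤₚ
open import Data.List using (List; []; _∷_; _++_; map; foldr; concatMap; length; filter; deduplicate; applyUpTo; upTo)
open import Data.List.Membership.Propositional using (_∈_; lose)
open import Data.List.Membership.DecPropositional ℕ._≟_ using (_∈?_)
import Data.List.Membership.Propositional.Properties as ∈ₚ
import Data.List.Properties as Listₚ
open import Data.List.Relation.Binary.Permutation.Propositional using (_↭_; ↭-refl; ↭-sym; ↭-trans; prep)
open import Data.List.Relation.Binary.Permutation.Propositional.Properties using (shift; ∈-resp-↭; ↭-length)
open import Data.List.Relation.Binary.Subset.Propositional using (_⊆_)
open import Data.List.Relation.Unary.All as All using (All; []; _∷_)
open import Data.List.Relation.Unary.AllPairs using (_∷_)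
open import Data.List.Relation.Unary.Any using (here; there)
open import Data.List.Relation.Unary.Unique.Propositional using (Unique)
import Data.List.Relation.Unary.Unique.Propositional.Properties as Uniqueₚ
open import Data.List.Relation.Unary.Unique.DecPropositional.Properties using (deduplicate-!)
import Data.Nat.Coprimality as Coprime
open import Data.Nat.Divisibility as Div using (_∣_; _∣?_; divides)
open import Data.Nat.ListAction using (product)
open import Data.Nat.ListAction.Properties using (product-↭; product-++; ∈⇒∣product; product≢0)
import Data.Nat.Properties as ℕₚ
import Data.Nat.Solver as ℕSolver
open import Data.Product using (_×_; _,_; proj₁; proj₂; ∃)
import Data.Product as Product
open import Data.Rational using (mkℚ; _+_; _*_; -_; _/_; _≤?_)
import Data.Rational as ℚ
import Data.Rational.Properties as ℚₚ
open import Data.Rational.Solver using (module +-*-Solver)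
import Data.Rational.Unnormalised as ℚᵘ
import Data.Rational.Unnormalised.Properties as ℚᵘₚ
open import Data.Sum using (inj₁; inj₂; [_,_]′)
open import Data.Vec as Vec using (Vec; []; _∷_; tabulate; lookup)
open import Data.Vec.Properties using (lookup∘tabulate; []=⇒lookup; lookup⇒[]=)
open import Function using (_∘_)
open import Function.Bundles using (Equivalence)
open import Relation.Binary.Definitions using (tri<; tri≈; tri>)
open import Relation.Binary.PropositionalEquality
open import Relation.Nullary using (Dec; yes; no; does; isYes; ¬_; ¬?; contradiction)
open import Relation.Nullary.Decidable using (toWitness; _×-dec_; dec-true; decidable-stable)

open import Algebra.Properties.CommutativeSemiring.Exp
  (CommutativeRing.commutativeSemiring ℚₚ.+-*-commutativeRing)
  using (_^_; ^-homo-*; ^-assocʳ; ^-distrib-*)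

fromℕ : ℕ → ℚ
fromℕ k = ℤ.+ k / 1

private
  fromℕ-nf : ℕ → ℚ
  fromℕ-nf k = mkℚ (ℤ.+ k) 0 (Coprime.sym (Coprime.1-coprimeTo k))

  fromℕ≡nf : ∀ k → fromℕ k ≡ fromℕ-nf k
  fromℕ≡nf k = ℚₚ.normalize-coprime (Coprime.sym (Coprime.1-coprimeTo k))

fromℕ-mono-≤ : ∀ {a b} → a ℕ.≤ b → fromℕ a ≤ fromℕ b
fromℕ-mono-≤ {a} {b} a≤b rewrite fromℕ≡nf a | fromℕ≡nf b =
  ℚ.*≤* (ℤₚ.*-monoʳ-≤-nonNeg (ℤ.+ 1) (ℤ.+≤+ a≤b))

fromℕ-nonNeg : ∀ k → 0ℚ ≤ fromℕ k
fromℕ-nonNeg k = fromℕ-mono-≤ {0} {k} ℕ.z≤n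

fromℕ-+ : ∀ a b → fromℕ (a ℕ.+ b) ≡ fromℕ a + fromℕ b
fromℕ-+ a b rewrite fromℕ≡nf a | fromℕ≡nf b | fromℕ≡nf (a ℕ.+ b) =
  ℚₚ.toℚᵘ-injective (ℚᵘₚ.≃-trans (ℚᵘ.*≡* eq) (ℚᵘₚ.≃-sym (ℚₚ.toℚᵘ-homo-+ (fromℕ-nf a) (fromℕ-nf b))))
  where
  eq : ℤ.+ (a ℕ.+ b) ℤ.* ℤ.+ 1 ≡ (ℤ.+ a ℤ.* ℤ.+ 1 ℤ.+ ℤ.+ b ℤ.* ℤ.+ 1) ℤ.* ℤ.+ 1
  eq rewrite ℤₚ.*-identityʳ (ℤ.+ a) | ℤₚ.*-identityʳ (ℤ.+ b) = refl

fromℕ-* : ∀ a b → fromℕ (a ℕ.* b) ≡ fromℕ a * fromℕ b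
fromℕ-* a b rewrite fromℕ≡nf a | fromℕ≡nf b | fromℕ≡nf (a ℕ.* b) =
  ℚₚ.toℚᵘ-injective (ℚᵘₚ.≃-trans (ℚᵘ.*≡* eq) (ℚᵘₚ.≃-sym (ℚₚ.toℚᵘ-homo-* (fromℕ-nf a) (fromℕ-nf b))))
  where
  eq : ℤ.+ (a ℕ.* b) ℤ.* ℤ.+ 1 ≡ (ℤ.+ a ℤ.* ℤ.+ b) ℤ.* ℤ.+ 1
  eq = cong (ℤ._* ℤ.+ 1) (ℤₚ.pos-* a b)

fromℕ-^ : ∀ a k → fromℕ (a ℕ.^ k) ≡ fromℕ a ^ k
fromℕ-^ a zero    = refl
fromℕ-^ a (suc k) = trans (fromℕ-* a (a ℕ.^ k)) (cong (fromℕ a *_) (fromℕ-^ a k))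

*-nonNeg : ∀ {a b} → 0ℚ ≤ a → 0ℚ ≤ b → 0ℚ ≤ a * b
*-nonNeg {a} {b} a≥0 b≥0 = ℚₚ.nonNegative⁻¹ _
  {{ℚₚ.nonNeg*nonNeg⇒nonNeg a {{ℚ.nonNegative a≥0}} b {{ℚ.nonNegative b≥0}}}}

*-monoˡ-≤ : ∀ {c a b} → 0ℚ ≤ c → a ≤ b → c * a ≤ c * b
*-monoˡ-≤ {c} c≥0 = ℚₚ.*-monoˡ-≤-nonNeg c {{ℚ.nonNegative c≥0}}

*-monoʳ-≤ : ∀ {c a b} → 0ℚ ≤ c → a ≤ b → a * c ≤ b * c
*-monoʳ-≤ {c} c≥0 = ℚₚ.*-monoʳ-≤-nonNeg c {{ℚ.nonNegative c≥0}}

*-mono-≤ : ∀ {a b c d} → 0ℚ ≤ b → 0ℚ ≤ c → a ≤ b → c ≤ d → a * c ≤ b * d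
*-mono-≤ {a} {b} {c} {d} b≥0 c≥0 a≤b c≤d = begin
  a * c ≤⟨ *-monoʳ-≤ c≥0 a≤b ⟩
  b * c ≤⟨ *-monoˡ-≤ b≥0 c≤d ⟩
  b * d ∎
  where open ℚₚ.≤-Reasoning

0≤1 : 0ℚ ≤ 1ℚ
0≤1 = ℚₚ.nonNegative⁻¹ 1ℚ

^-nonNeg : ∀ {x} k → 0ℚ ≤ x → 0ℚ ≤ x ^ k
^-nonNeg zero    x≥0 = 0≤1
^-nonNeg (suc k) x≥0 = *-nonNeg x≥0 (^-nonNeg k x≥0)

^-≤1 : ∀ {x} k → 0ℚ ≤ x → x ≤ 1ℚ → x ^ k ≤ 1ℚ
^-≤1 zero    x≥0 x≤1 = ℚₚ.≤-refl
^-≤1 (suc k) x≥0 x≤1 = *-mono-≤ 0≤1 (^-nonNeg k x≥0) x≤1 (^-≤1 k x≥0 x≤1)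

1≤^ : ∀ {x} k → 1ℚ ≤ x → 1ℚ ≤ x ^ k
1≤^ zero    x≥1 = ℚₚ.≤-refl
1≤^ (suc k) x≥1 = *-mono-≤ (ℚₚ.≤-trans 0≤1 x≥1) 0≤1 x≥1 (1≤^ k x≥1)

^-antimonoʳ-≤ : ∀ {x k m} → 0ℚ ≤ x → x ≤ 1ℚ → k ℕ.≤ m → x ^ m ≤ x ^ k
^-antimonoʳ-≤ {x} {k} {m} x≥0 x≤1 k≤m = begin
  x ^ m                 ≡⟨ cong (x ^_) (sym (ℕₚ.m+[n∸m]≡n k≤m)) ⟩
  x ^ (k ℕ.+ (m ℕ.∸ k)) ≡⟨ ^-homo-* x k (m ℕ.∸ k) ⟩
  x ^ k * x ^ (m ℕ.∸ k) ≤⟨ *-monoˡ-≤ (^-nonNeg k x≥0) (^-≤1 (m ℕ.∸ k) x≥0 x≤1) ⟩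
  x ^ k * 1ℚ            ≡⟨ ℚₚ.*-identityʳ _ ⟩
  x ^ k                 ∎
  where open ℚₚ.≤-Reasoning

^-monoʳ-≤ : ∀ {x k m} → 1ℚ ≤ x → k ℕ.≤ m → x ^ k ≤ x ^ m
^-monoʳ-≤ {x} {k} {m} x≥1 k≤m = begin
  x ^ k                 ≡⟨ sym (ℚₚ.*-identityʳ _) ⟩
  x ^ k * 1ℚ            ≤⟨ *-monoˡ-≤ (^-nonNeg k (ℚₚ.≤-trans 0≤1 x≥1)) (1≤^ (m ℕ.∸ k) x≥1) ⟩
  x ^ k * x ^ (m ℕ.∸ k) ≡⟨ sym (^-homo-* x k (m ℕ.∸ k)) ⟩
  x ^ (k ℕ.+ (m ℕ.∸ k)) ≡⟨ cong (x ^_) (ℕₚ.m+[n∸m]≡n k≤m) ⟩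
  x ^ m                 ∎
  where open ℚₚ.≤-Reasoning

^-≤1⇒≤1 : ∀ {y} k → 0ℚ ≤ y → y ^ suc k ≤ 1ℚ → y ≤ 1ℚ
^-≤1⇒≤1 {y} k y≥0 y^≤1 with ℚₚ.≤-total y 1ℚ
... | inj₁ y≤1 = y≤1
... | inj₂ y≥1 = ℚₚ.≤-trans (begin
  y          ≡⟨ sym (ℚₚ.*-identityʳ y) ⟩
  y * 1ℚ     ≤⟨ *-monoˡ-≤ y≥0 (1≤^ k y≥1) ⟩
  y ^ suc k  ∎) y^≤1
  where open ℚₚ.≤-Reasoning

∑ : {A : Set} → List A → (A → ℚ) → ℚ
∑ xs f = foldr _+_ 0ℚ (map f xs)

module _ {A : Set} where

  ∑-++ : (xs ys : List A) (f : A → ℚ) → ∑ (xs ++ ys) f ≡ ∑ xs f + ∑ ys f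
  ∑-++ []       ys f = sym (ℚₚ.+-identityˡ _)
  ∑-++ (x ∷ xs) ys f = trans (cong (f x +_) (∑-++ xs ys f)) (sym (ℚₚ.+-assoc (f x) _ _))

  ∑-map : {B : Set} (g : A → B) (xs : List A) (f : B → ℚ) → ∑ (map g xs) f ≡ ∑ xs (f ∘ g)
  ∑-map g []       f = refl
  ∑-map g (x ∷ xs) f = cong (f (g x) +_) (∑-map g xs f)

  ∑-cong : (xs : List A) {f g : A → ℚ} → (∀ x → f x ≡ g x) → ∑ xs f ≡ ∑ xs g
  ∑-cong []       f≗g = refl
  ∑-cong (x ∷ xs) f≗g = cong₂ _+_ (f≗g x) (∑-cong xs f≗g)

  ∑-mono-≤ : (xs : List A) {f g : A → ℚ} → (∀ x → x ∈ xs → f x ≤ g x) → ∑ xs f ≤ ∑ xs g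
  ∑-mono-≤ []       f≤g = ℚₚ.≤-refl
  ∑-mono-≤ (x ∷ xs) f≤g = ℚₚ.+-mono-≤ (f≤g x (here refl)) (∑-mono-≤ xs (λ y y∈ → f≤g y (there y∈)))

  ∑-+ : (xs : List A) (f g : A → ℚ) → ∑ xs (λ x → f x + g x) ≡ ∑ xs f + ∑ xs g
  ∑-+ []       f g = refl
  ∑-+ (x ∷ xs) f g = trans (cong (f x + g x +_) (∑-+ xs f g))
    (solve 4 (λ a b c d → (a :+ b) :+ (c :+ d) := (a :+ c) :+ (b :+ d)) refl (f x) (g x) (∑ xs f) (∑ xs g))
    where open +-*-Solver

  ∑-*ˡ : (xs : List A) (c : ℚ) (f : A → ℚ) → ∑ xs (λ x → c * f x) ≡ c * ∑ xs f
  ∑-*ˡ []       c f = sym (ℚₚ.*-zeroʳ c)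
  ∑-*ˡ (x ∷ xs) c f = trans (cong (c * f x +_) (∑-*ˡ xs c f)) (sym (ℚₚ.*-distribˡ-+ c (f x) _))

  ∑-const : (xs : List A) (c : ℚ) → ∑ xs (λ _ → c) ≡ fromℕ (length xs) * c
  ∑-const []       c = sym (ℚₚ.*-zeroˡ c)
  ∑-const (x ∷ xs) c = begin-equality
    c + ∑ xs (λ _ → c)           ≡⟨ cong (c +_) (∑-const xs c) ⟩
    c + fromℕ (length xs) * c    ≡⟨ solve 2 (λ c l → c :+ l :* c := (con 1ℚ :+ l) :* c) refl c (fromℕ (length xs)) ⟩
    (1ℚ + fromℕ (length xs)) * c ≡⟨ cong (_* c) (sym (fromℕ-+ 1 (length xs))) ⟩
    fromℕ (suc (length xs)) * c  ∎
    where open +-*-Solver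
          open ℚₚ.≤-Reasoning

  ∑-nonNeg : (xs : List A) {f : A → ℚ} → (∀ x → 0ℚ ≤ f x) → 0ℚ ≤ ∑ xs f
  ∑-nonNeg []       f≥0 = ℚₚ.≤-refl
  ∑-nonNeg (x ∷ xs) f≥0 = ℚₚ.+-mono-≤ (f≥0 x) (∑-nonNeg xs f≥0)

  term≤∑ : {xs : List A} {f : A → ℚ} → (∀ x → 0ℚ ≤ f x) → ∀ {x} → x ∈ xs → f x ≤ ∑ xs f
  term≤∑ {y ∷ xs} {f} f≥0 (here refl) = begin
    f y          ≡⟨ sym (ℚₚ.+-identityʳ _) ⟩
    f y + 0ℚ     ≤⟨ ℚₚ.+-monoʳ-≤ (f y) (∑-nonNeg xs f≥0) ⟩
    f y + ∑ xs f ∎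
    where open ℚₚ.≤-Reasoning
  term≤∑ {y ∷ xs} {f} f≥0 {x} (there x∈) = begin
    f x          ≡⟨ sym (ℚₚ.+-identityˡ _) ⟩
    0ℚ + f x     ≤⟨ ℚₚ.+-mono-≤ (f≥0 y) (term≤∑ f≥0 x∈) ⟩
    f y + ∑ xs f ∎
    where open ℚₚ.≤-Reasoning

∑-swap : {A B : Set} (xs : List A) (ys : List B) (F : A → B → ℚ) →
         ∑ xs (λ x → ∑ ys (F x)) ≡ ∑ ys (λ y → ∑ xs (λ x → F x y))
∑-swap []       ys F = sym (trans (∑-const ys 0ℚ) (ℚₚ.*-zeroʳ (fromℕ (length ys))))
∑-swap (x ∷ xs) ys F = trans (cong (∑ ys (F x) +_) (∑-swap xs ys F)) (sym (∑-+ ys (F x) _))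

∑-concatMap : {A B : Set} (G : A → List B) (xs : List A) (f : B → ℚ) →
              ∑ (concatMap G xs) f ≡ ∑ xs (λ x → ∑ (G x) f)
∑-concatMap G []       f = refl
∑-concatMap G (x ∷ xs) f = trans (∑-++ (G x) (concatMap G xs) f) (cong (∑ (G x) f +_) (∑-concatMap G xs f))

∑-concatMap-≤ : {A B : Set} (G : A → List B) {xs : List A} {f : B → ℚ} {L : ℕ} {β : ℚ} →
                length xs ℕ.≤ L → 0ℚ ≤ β → (∀ x → x ∈ xs → ∑ (G x) f ≤ β) → ∑ (concatMap G xs) f ≤ fromℕ L * β
∑-concatMap-≤ G {xs} {f} {L} {β} |xs|≤L β≥0 G≤β = begin
  ∑ (concatMap G xs) f          ≡⟨ ∑-concatMap G xs f ⟩
  ∑ xs (λ x → ∑ (G x) f)        ≤⟨ ∑-mono-≤ xs G≤β ⟩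
  ∑ xs (λ _ → β)                ≡⟨ ∑-const xs β ⟩
  fromℕ (length xs) * β         ≤⟨ *-monoʳ-≤ β≥0 (fromℕ-mono-≤ |xs|≤L) ⟩
  fromℕ L * β                   ∎
  where open ℚₚ.≤-Reasoning

-- Defined through `does` so that 𝟙 (m ⊆? S) computes through the Dec.map inside _⊆?_.
𝟙 : {A : Set} → Dec A → ℚ
𝟙 a? = if does a? then 1ℚ else 0ℚ

𝔼 : (n : ℕ) → ℚ → (Subset n → ℚ) → ℚ
𝔼 n p f = ∑ (allSubsets n) (λ S → weight p S * f S)

𝟙-nonNeg : {A : Set} (a? : Dec A) → 0ℚ ≤ 𝟙 a?
𝟙-nonNeg a? with does a?
... | true  = 0≤1
... | false = ℚₚ.≤-refl

𝟙-yes : {A : Set} (a? : Dec A) → A → 𝟙 a? ≡ 1ℚ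
𝟙-yes a? a = cong (if_then 1ℚ else 0ℚ) (dec-true a? a)

module _ (p : ℚ) where

  𝔼-suc : ∀ n f → 𝔼 (suc n) p f ≡ p * 𝔼 n p (f ∘ (inside ∷_)) + (1ℚ - p) * 𝔼 n p (f ∘ (outside ∷_))
  𝔼-suc n f = begin-equality
    ∑ (map (inside ∷_) A ++ map (outside ∷_) A) F
      ≡⟨ ∑-++ (map (inside ∷_) A) _ F ⟩
    ∑ (map (inside ∷_) A) F + ∑ (map (outside ∷_) A) F
      ≡⟨ cong₂ _+_ (trans (∑-map _ A F) (scaled p _)) (trans (∑-map _ A F) (scaled (1ℚ - p) _)) ⟩
    p * 𝔼 n p (f ∘ (inside ∷_)) + (1ℚ - p) * 𝔼 n p (f ∘ (outside ∷_)) ∎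
    where
    open ℚₚ.≤-Reasoning
    A : List (Subset n)
    A = allSubsets n
    F : Subset (suc n) → ℚ
    F S = weight p S * f S
    scaled : ∀ c g → ∑ A (λ S → (c * weight p S) * g S) ≡ c * 𝔼 n p g
    scaled c g = trans (∑-cong A (λ S → ℚₚ.*-assoc c _ _)) (∑-*ˡ A c _)

  𝔼-const : ∀ n c → 𝔼 n p (λ _ → c) ≡ c
  𝔼-const zero    c = trans (ℚₚ.+-identityʳ _) (ℚₚ.*-identityˡ c)
  𝔼-const (suc n) c = begin-equality
    𝔼 (suc n) p (λ _ → c)
      ≡⟨ 𝔼-suc n (λ _ → c) ⟩
    p * 𝔼 n p (λ _ → c) + (1ℚ - p) * 𝔼 n p (λ _ → c)
      ≡⟨ cong₂ (λ a b → p * a + (1ℚ - p) * b) (𝔼-const n c) (𝔼-const n c) ⟩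
    p * c + (1ℚ - p) * c
      ≡⟨ solve 2 (λ p c → p :* c :+ (con 1ℚ :- p) :* c := c) refl p c ⟩
    c ∎
    where open +-*-Solver
          open ℚₚ.≤-Reasoning

  𝔼-𝟙-⊆ : ∀ {n} (m : Subset n) → 𝔼 n p (λ S → 𝟙 (m ⊆? S)) ≡ p ^ ∣ m ∣
  𝔼-𝟙-⊆ [] = refl
  𝔼-𝟙-⊆ {suc n} (inside ∷ m) = begin-equality
    𝔼 (suc n) p (λ S → 𝟙 (inside ∷ m ⊆? S))
      ≡⟨ 𝔼-suc n _ ⟩
    p * 𝔼 n p (λ S → 𝟙 (m ⊆? S)) + (1ℚ - p) * 𝔼 n p (λ _ → 0ℚ)
      ≡⟨ cong₂ (λ a b → p * a + (1ℚ - p) * b) (𝔼-𝟙-⊆ m) (𝔼-const n 0ℚ) ⟩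
    p * p ^ ∣ m ∣ + (1ℚ - p) * 0ℚ
      ≡⟨ solve 2 (λ p a → p :* a :+ (con 1ℚ :- p) :* con 0ℚ := p :* a) refl p (p ^ ∣ m ∣) ⟩
    p * p ^ ∣ m ∣ ∎
    where open +-*-Solver
          open ℚₚ.≤-Reasoning
  𝔼-𝟙-⊆ {suc n} (outside ∷ m) = begin-equality
    𝔼 (suc n) p (λ S → 𝟙 (outside ∷ m ⊆? S))
      ≡⟨ 𝔼-suc n _ ⟩
    p * 𝔼 n p (λ S → 𝟙 (m ⊆? S)) + (1ℚ - p) * 𝔼 n p (λ S → 𝟙 (m ⊆? S))
      ≡⟨ cong (λ a → p * a + (1ℚ - p) * a) (𝔼-𝟙-⊆ m) ⟩
    p * p ^ ∣ m ∣ + (1ℚ - p) * p ^ ∣ m ∣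
      ≡⟨ solve 2 (λ p a → p :* a :+ (con 1ℚ :- p) :* a := a) refl p (p ^ ∣ m ∣) ⟩
    p ^ ∣ m ∣ ∎
    where open +-*-Solver
          open ℚₚ.≤-Reasoning

-- The summand of Pr is local to its definition; `summand` recovers it by unification.
Pr≡𝔼𝟙 : ∀ n p {P : Subset n → Set} (P? : Decidable P) → Pr n p P P? ≡ 𝔼 n p (λ S → 𝟙 (P? S))
Pr≡𝔼𝟙 n p {P} P? = trans (proj₂ summand) (∑-cong (allSubsets n) summand≡)
  where
  summand : Σ (Subset n → ℚ) λ t → Pr n p P P? ≡ ∑ (allSubsets n) t
  summand = _ , refl
  summand≡ : ∀ S → proj₁ summand S ≡ weight p S * 𝟙 (P? S)
  summand≡ S with P? S
  ... | yes _ = sym (ℚₚ.*-identityʳ (weight p S))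
  ... | no  _ = sym (ℚₚ.*-zeroʳ (weight p S))

weight-nonNeg : ∀ {n p} → 0ℚ ≤ p → p ≤ 1ℚ → (S : Subset n) → 0ℚ ≤ weight p S
weight-nonNeg         p≥0 p≤1 []            = 0≤1
weight-nonNeg         p≥0 p≤1 (inside ∷ S)  = *-nonNeg p≥0 (weight-nonNeg p≥0 p≤1 S)
weight-nonNeg {p = p} p≥0 p≤1 (outside ∷ S) = *-nonNeg 1-p≥0 (weight-nonNeg p≥0 p≤1 S)
  where
  1-p≥0 : 0ℚ ≤ 1ℚ - p
  1-p≥0 = ℚₚ.≤-trans (ℚₚ.≤-reflexive (sym (ℚₚ.+-inverseʳ p))) (ℚₚ.+-monoˡ-≤ (- p) p≤1)

𝔼-mono-≤ : ∀ {n p} → 0ℚ ≤ p → p ≤ 1ℚ → {f g : Subset n → ℚ} → (∀ S → f S ≤ g S) → 𝔼 n p f ≤ 𝔼 n p g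
𝔼-mono-≤ {n} p≥0 p≤1 f≤g = ∑-mono-≤ (allSubsets n) (λ S _ → *-monoˡ-≤ (weight-nonNeg p≥0 p≤1 S) (f≤g S))

𝔼-+ : ∀ n p (f g : Subset n → ℚ) → 𝔼 n p (λ S → f S + g S) ≡ 𝔼 n p f + 𝔼 n p g
𝔼-+ n p f g = trans (∑-cong (allSubsets n) (λ S → ℚₚ.*-distribˡ-+ (weight p S) (f S) (g S))) (∑-+ (allSubsets n) _ _)

𝔼-∑ : ∀ n p {E : Set} (es : List E) (h : E → Subset n → ℚ) →
      𝔼 n p (λ S → ∑ es (λ e → h e S)) ≡ ∑ es (λ e → 𝔼 n p (h e))
𝔼-∑ n p es h = trans (∑-cong (allSubsets n) (λ S → sym (∑-*ˡ es (weight p S) (λ e → h e S))))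
                     (∑-swap (allSubsets n) es (λ S e → weight p S * h e S))

𝔼-*ˡ : ∀ n p c (g : Subset n → ℚ) → 𝔼 n p (λ S → c * g S) ≡ c * 𝔼 n p g
𝔼-*ˡ n p c g = trans
  (∑-cong (allSubsets n) (λ S → solve 3 (λ w c g → w :* (c :* g) := c :* (w :* g)) refl (weight p S) c (g S)))
  (∑-*ˡ (allSubsets n) c _)
  where open +-*-Solver

union-bound : ∀ {n p} → 0ℚ ≤ p → p ≤ 1ℚ → {P : Subset n → Set} (P? : Decidable P)
              {E : Set} (es : List E) (h : E → Subset n → ℚ) → (∀ e S → 0ℚ ≤ h e S) →
              (∀ S → ¬ P S → 1ℚ ≤ ∑ es (λ e → h e S)) →
              1ℚ ≤ Pr n p P P? + ∑ es (λ e → 𝔼 n p (h e))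
union-bound {n} {p} p≥0 p≤1 {P} P? es h h≥0 covers = begin
  1ℚ                                       ≡⟨ sym (𝔼-const p n 1ℚ) ⟩
  𝔼 n p (λ _ → 1ℚ)                         ≤⟨ 𝔼-mono-≤ p≥0 p≤1 pointwise ⟩
  𝔼 n p (λ S → 𝟙 (P? S) + H S)             ≡⟨ 𝔼-+ n p _ H ⟩
  𝔼 n p (λ S → 𝟙 (P? S)) + 𝔼 n p H         ≡⟨ cong₂ _+_ (sym (Pr≡𝔼𝟙 n p P?)) (𝔼-∑ n p es h) ⟩
  Pr n p P P? + ∑ es (λ e → 𝔼 n p (h e))   ∎
  where
  open ℚₚ.≤-Reasoning
  H : Subset n → ℚ
  H S = ∑ es (λ e → h e S)
  pointwise : ∀ S → 1ℚ ≤ 𝟙 (P? S) + H S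
  pointwise S with P? S
  ... | yes _  = ℚₚ.≤-trans (ℚₚ.≤-reflexive (sym (ℚₚ.+-identityʳ 1ℚ))) (ℚₚ.+-monoʳ-≤ 1ℚ (∑-nonNeg es (λ e → h≥0 e S)))
  ... | no ¬PS = ℚₚ.≤-trans (covers S ¬PS) (ℚₚ.≤-reflexive (sym (ℚₚ.+-identityˡ (H S))))

module _ {A : Set} where

  Unique-⊆⇒↭++ : {us xs : List A} → Unique us → us ⊆ xs → ∃ λ rest → xs ↭ us ++ rest
  Unique-⊆⇒↭++ {[]}     {xs} _              _    = xs , ↭-refl
  Unique-⊆⇒↭++ {u ∷ us} (u∉us ∷ us-unique) us⊆xs with ∈ₚ.∈-∃++ (us⊆xs (here refl))
  ... | ys , zs , refl =
    Product.map₂ (λ ys++zs↭ → ↭-trans (shift u ys zs) (prep u ys++zs↭)) (Unique-⊆⇒↭++ us-unique us⊆ys++zs)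
    where
    us⊆ys++zs : us ⊆ ys ++ zs
    us⊆ys++zs z∈us with ∈-resp-↭ (shift u ys zs) (us⊆xs (there z∈us))
    ... | here z≡u = contradiction (sym z≡u) (All.lookup u∉us z∈us)
    ... | there z∈ = z∈

  Unique-⊆⇒length≤ : {us xs : List A} → Unique us → us ⊆ xs → length us ℕ.≤ length xs
  Unique-⊆⇒length≤ {us} us-unique us⊆xs with Unique-⊆⇒↭++ us-unique us⊆xs
  ... | rest , xs↭ = ℕₚ.≤-trans (ℕₚ.m≤m+n (length us) (length rest))
                       (ℕₚ.≤-reflexive (sym (trans (↭-length xs↭) (Listₚ.length-++ us))))

*-^-distrib : ∀ a b k → (a ℕ.* b) ℕ.^ k ≡ a ℕ.^ k ℕ.* b ℕ.^ k
*-^-distrib a b zero    = refl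
*-^-distrib a b (suc k) = begin-equality
  (a ℕ.* b) ℕ.* (a ℕ.* b) ℕ.^ k
    ≡⟨ cong ((a ℕ.* b) ℕ.*_) (*-^-distrib a b k) ⟩
  (a ℕ.* b) ℕ.* (a ℕ.^ k ℕ.* b ℕ.^ k)
    ≡⟨ solve 4 (λ a b x y → (a :* b) :* (x :* y) := (a :* x) :* (b :* y)) refl a b (a ℕ.^ k) (b ℕ.^ k) ⟩
  (a ℕ.* a ℕ.^ k) ℕ.* (b ℕ.* b ℕ.^ k) ∎
  where open ℕₚ.≤-Reasoning
        open ℕSolver.+-*-Solver

^length≤product^ : ∀ {m n} xs → All (λ t → n ℕ.≤ t ℕ.^ m) xs → n ℕ.^ length xs ℕ.≤ product xs ℕ.^ m
^length≤product^ {m}     []       []           = ℕₚ.≤-reflexive (sym (ℕₚ.^-zeroˡ m))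
^length≤product^ {m} {n} (x ∷ xs) (n≤x^m ∷ xs≥) = begin
  n ℕ.* n ℕ.^ length xs            ≤⟨ ℕₚ.*-mono-≤ n≤x^m (^length≤product^ {m} xs xs≥) ⟩
  x ℕ.^ m ℕ.* product xs ℕ.^ m     ≡⟨ sym (*-^-distrib x (product xs) m) ⟩
  (x ℕ.* product xs) ℕ.^ m         ∎
  where open ℕₚ.≤-Reasoning

module _ {us xs : List ℕ} (us-unique : Unique us) (us⊆xs : us ⊆ xs) where

  private
    rest : List ℕ
    rest = proj₁ (Unique-⊆⇒↭++ us-unique us⊆xs)

    xs↭us++rest : xs ↭ us ++ rest
    xs↭us++rest = proj₂ (Unique-⊆⇒↭++ us-unique us⊆xs)

    product-split : product xs ≡ product us ℕ.* product rest
    product-split = trans (product-↭ xs↭us++rest) (product-++ us rest)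

  Unique-⊆⇒product∣ : product us ∣ product xs
  Unique-⊆⇒product∣ = divides (product rest) (trans product-split (ℕₚ.*-comm (product us) _))

  Unique-⊆⇒product^-bound : ∀ {m n} → All (λ t → n ℕ.≤ t ℕ.^ m) xs →
    product us ℕ.^ m ℕ.* n ℕ.^ (length xs ℕ.∸ length us) ℕ.≤ product xs ℕ.^ m
  Unique-⊆⇒product^-bound {m} {n} xs≥ = begin
    product us ℕ.^ m ℕ.* n ℕ.^ (length xs ℕ.∸ length us)   ≡⟨ cong (λ k → product us ℕ.^ m ℕ.* n ℕ.^ k) length-rest ⟩
    product us ℕ.^ m ℕ.* n ℕ.^ length rest                  ≤⟨ ℕₚ.*-monoʳ-≤ (product us ℕ.^ m) (^length≤product^ {m} rest rest≥) ⟩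
    product us ℕ.^ m ℕ.* product rest ℕ.^ m                 ≡⟨ sym (*-^-distrib (product us) (product rest) m) ⟩
    (product us ℕ.* product rest) ℕ.^ m                     ≡⟨ cong (ℕ._^ m) (sym product-split) ⟩
    product xs ℕ.^ m                                        ∎
    where
    open ℕₚ.≤-Reasoning
    length-rest : length xs ℕ.∸ length us ≡ length rest
    length-rest = trans (cong (ℕ._∸ length us) (trans (↭-length xs↭us++rest) (Listₚ.length-++ us)))
                        (ℕₚ.m+n∸m≡n (length us) (length rest))
    rest≥ : All (λ t → n ℕ.≤ t ℕ.^ m) rest
    rest≥ = All.tabulate (λ t∈rest → All.lookup xs≥ (∈-resp-↭ (↭-sym xs↭us++rest) (∈ₚ.∈-++⁺ʳ us t∈rest)))

oneTo : ℕ → List ℕ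
oneTo = applyUpTo suc

∈-oneTo : ∀ {n t} → 1 ℕ.≤ t → t ℕ.≤ n → t ∈ oneTo n
∈-oneTo {t = suc t} _ t<n = ∈ₚ.∈-applyUpTo⁺ suc t<n

length-oneTo : ∀ n → length (oneTo n) ≡ n
length-oneTo = Listₚ.length-applyUpTo suc

footprint : (n : ℕ) → List ℕ → Subset n
footprint n K = tabulate (λ i → isYes (suc (toℕ i) ∈? K))

∈-footprint⁻ : ∀ {n K} {i : Fin n} → i Subset.∈ footprint n K → suc (toℕ i) ∈ K
∈-footprint⁻ {n} {K} {i} i∈ = toWitness {a? = suc (toℕ i) ∈? K} (Equivalence.from T-≡
  (trans (sym (lookup∘tabulate (λ j → isYes (suc (toℕ j) ∈? K)) i)) ([]=⇒lookup i∈)))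

footprint-⊆ : ∀ {n K} {S : Subset n} → (∀ {t} → t ∈ K → t ∈ₛ S) → footprint n K Subset.⊆ S
footprint-⊆ {S = S} K⊆S {i} i∈ with K⊆S (∈-footprint⁻ i∈)
... | j , 1+j≡1+i , S[j] = lookup⇒[]= i S
  (subst (λ k → lookup S k ≡ true) (Finₚ.toℕ-injective (ℕₚ.suc-injective 1+j≡1+i)) S[j])

∣tabulate∣≡length-filter : ∀ {P : ℕ → Set} (P? : Decidable P) (f : ℕ → ℕ) n →
  ∣ tabulate {n = n} (λ i → isYes (P? (f (toℕ i)))) ∣ ≡ length (filter P? (applyUpTo f n))
∣tabulate∣≡length-filter P? f zero = refl
∣tabulate∣≡length-filter P? f (suc n) with P? (f 0)
... | yes _ = cong suc (∣tabulate∣≡length-filter P? (f ∘ suc) n)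
... | no  _ = ∣tabulate∣≡length-filter P? (f ∘ suc) n

length-deduplicate≤∣footprint∣ : ∀ {n K} → K ⊆ oneTo n → length (deduplicate ℕ._≟_ K) ℕ.≤ ∣ footprint n K ∣
length-deduplicate≤∣footprint∣ {n} {K} K⊆ = ℕₚ.≤-trans
  (Unique-⊆⇒length≤ (deduplicate-! ℕ._≟_ K) dedup⊆)
  (ℕₚ.≤-reflexive (sym (∣tabulate∣≡length-filter (_∈? K) suc n)))
  where
  dedup⊆ : deduplicate ℕ._≟_ K ⊆ filter (_∈? K) (oneTo n)
  dedup⊆ t∈ = ∈ₚ.∈-filter⁺ (_∈? K) (K⊆ (∈ₚ.∈-deduplicate⁻ ℕ._≟_ K t∈)) (∈ₚ.∈-deduplicate⁻ ℕ._≟_ K t∈)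

divisors : ℕ → List ℕ
divisors m = filter (_∣? m) (oneTo m)

length-divisors : ∀ m → length (divisors m) ≡ d m
length-divisors m = cong (length ∘ filter (_∣? m)) (sym (Listₚ.map-applyUpTo (λ k → k) suc m))

∈-divisors : ∀ {k m} → k ∣ m → 1 ℕ.≤ m → k ∈ divisors m
∈-divisors {zero}  {m} k∣m 1≤m = contradiction (Div.0∣⇒≡0 k∣m) (ℕₚ.>⇒≢ 1≤m)
∈-divisors {suc k} {m} k∣m 1≤m =
  ∈ₚ.∈-filter⁺ (_∣? m) (∈-oneTo (ℕ.s≤s ℕ.z≤n) (Div.∣⇒≤ {{ℕ.>-nonZero 1≤m}} k∣m)) k∣m

d≤D : ∀ {m n} → 1 ℕ.≤ m → m ℕ.≤ n → d m ℕ.≤ D n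
d≤D {suc m} {n} _ m<n = ≤-max (∈ₚ.∈-map⁺ suc (∈ₚ.∈-upTo⁺ m<n))
  where
  ≤-max : ∀ {xs} → suc m ∈ xs → d (suc m) ℕ.≤ foldr ℕ._⊔_ 0 (map d xs)
  ≤-max {_ ∷ xs} (here refl) = ℕₚ.m≤m⊔n (d (suc m)) _
  ≤-max {x ∷ xs} (there m∈)  = ℕₚ.≤-trans (≤-max m∈) (ℕₚ.m≤n⊔m (d x) _)

^-injectiveʳ : ∀ {m} → 1 ℕ.< m → ∀ {i j} → m ℕ.^ i ≡ m ℕ.^ j → i ≡ j
^-injectiveʳ {m} 1<m {i} {j} m^i≡m^j with ℕₚ.<-cmp i j
... | tri< i<j _ _ = contradiction m^i≡m^j (ℕₚ.<⇒≢ (ℕₚ.^-monoʳ-< m 1<m i<j))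
... | tri≈ _ i≡j _ = i≡j
... | tri> _ _ j<i = contradiction (sym m^i≡m^j) (ℕₚ.<⇒≢ (ℕₚ.^-monoʳ-< m 1<m j<i))

D-unbounded : ∀ {K n} → 2 ℕ.^ K ℕ.≤ n → suc K ℕ.≤ D n
D-unbounded {K} {n} 2^K≤n = begin
  suc K                          ≡⟨ sym (trans (Listₚ.length-map (2 ℕ.^_) (upTo (suc K))) (Listₚ.length-upTo (suc K))) ⟩
  length powers                  ≤⟨ Unique-⊆⇒length≤ powers-unique powers⊆divisors ⟩
  length (divisors (2 ℕ.^ K))    ≡⟨ length-divisors (2 ℕ.^ K) ⟩
  d (2 ℕ.^ K)                    ≤⟨ d≤D (ℕₚ.m^n>0 2 K) 2^K≤n ⟩
  D n                            ∎
  where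
  open ℕₚ.≤-Reasoning
  powers : List ℕ
  powers = map (2 ℕ.^_) (upTo (suc K))
  powers-unique : Unique powers
  powers-unique = Uniqueₚ.map⁺ (^-injectiveʳ (ℕ.s≤s (ℕ.s≤s ℕ.z≤n))) (Uniqueₚ.upTo⁺ (suc K))
  powers⊆divisors : powers ⊆ divisors (2 ℕ.^ K)
  powers⊆divisors p∈ with ∈ₚ.∈-map⁻ (2 ℕ.^_) p∈
  ... | i , i∈ , refl = ∈-divisors (Div.divides (2 ℕ.^ (K ℕ.∸ i)) 2^K≡) (ℕₚ.m^n>0 2 K)
    where
    i≤K : i ℕ.≤ K
    i≤K = ℕₚ.≤-pred (∈ₚ.∈-upTo⁻ i∈)
    2^K≡ : 2 ℕ.^ K ≡ 2 ℕ.^ (K ℕ.∸ i) ℕ.* 2 ℕ.^ i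
    2^K≡ = trans (cong (2 ℕ.^_) (sym (ℕₚ.m∸n+n≡m i≤K))) (ℕₚ.^-distribˡ-+-* 2 (K ℕ.∸ i) i)

-- D n bounds the number of divisors of m only for m ≤ n.
boundedDivisors : ℕ → ℕ → List ℕ
boundedDivisors n m with m ℕ.≤? n
... | yes _ = divisors m
... | no  _ = []

length-boundedDivisors≤D : ∀ n m → length (boundedDivisors n m) ℕ.≤ D n
length-boundedDivisors≤D n m with m ℕ.≤? n
length-boundedDivisors≤D n zero    | yes _   = ℕ.z≤n
length-boundedDivisors≤D n (suc m) | yes m<n = ℕₚ.≤-trans (ℕₚ.≤-reflexive (length-divisors (suc m))) (d≤D (ℕ.s≤s ℕ.z≤n) m<n)
... | no _ = ℕ.z≤n

∈-boundedDivisors : ∀ {n k m} → k ∣ m → 1 ℕ.≤ m → m ℕ.≤ n → k ∈ boundedDivisors n m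
∈-boundedDivisors {n} {k} {m} k∣m 1≤m m≤n with m ℕ.≤? n
... | yes _   = ∈-divisors k∣m 1≤m
... | no  m≰n = contradiction m≤n m≰n

module _ {P : ℕ → Set} (P? : Decidable P) where

  greatest : ℕ → ℕ
  greatest zero = zero
  greatest (suc k) with P? (suc k)
  ... | yes _ = suc k
  ... | no  _ = greatest k

  greatest-satisfies : P 0 → ∀ k → P (greatest k)
  greatest-satisfies P0 zero = P0
  greatest-satisfies P0 (suc k) with P? (suc k)
  ... | yes Pk = Pk
  ... | no  _  = greatest-satisfies P0 k

  greatest-maximal : ∀ {j} k → P j → j ℕ.≤ k → j ℕ.≤ greatest k
  greatest-maximal zero    Pj j≤0 = j≤0
  greatest-maximal (suc k) Pj j≤1+k with P? (suc k)
  ... | yes _  = j≤1+k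
  ... | no ¬Pk with ℕₚ.m≤n⇒m<n∨m≡n j≤1+k
  ...   | inj₁ j<1+k = greatest-maximal k Pj (ℕₚ.≤-pred j<1+k)
  ...   | inj₂ refl  = contradiction Pj ¬Pk

tuples : {A : Set} (k : ℕ) → List A → List (Vec A k)
tuples zero    xs = [] ∷ []
tuples (suc k) xs = concatMap (λ x → map (x ∷_) (tuples k xs)) xs

∈-tuples : {A : Set} {k : ℕ} {xs : List A} {v : Vec A k} → Vec.toList v ⊆ xs → v ∈ tuples k xs
∈-tuples {v = []}    _    = here refl
∈-tuples {v = t ∷ v} v⊆xs = ∈ₚ.∈-concatMap⁺ _ (lose (v⊆xs (here refl)) (∈ₚ.∈-map⁺ (t ∷_) (∈-tuples (v⊆xs ∘ there))))

∑-tuples-≤ : {A : Set} (k : ℕ) (xs : List A) {f : Vec A k → ℚ} {L : ℕ} {β : ℚ} →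
             length xs ℕ.≤ L → 0ℚ ≤ β → (∀ v → f v ≤ β) → ∑ (tuples k xs) f ≤ fromℕ L ^ k * β
∑-tuples-≤ zero    xs {f} {β = β} _ _ f≤β = begin
  f [] + 0ℚ   ≡⟨ ℚₚ.+-identityʳ (f []) ⟩
  f []        ≤⟨ f≤β [] ⟩
  β           ≡⟨ sym (ℚₚ.*-identityˡ β) ⟩
  1ℚ * β      ∎
  where open ℚₚ.≤-Reasoning
∑-tuples-≤ (suc k) xs {f} {L} {β} |xs|≤L β≥0 f≤β = begin
  ∑ (tuples (suc k) xs) f               ≤⟨ ∑-concatMap-≤ _ |xs|≤L (*-nonNeg (^-nonNeg k (fromℕ-nonNeg L)) β≥0) each ⟩
  fromℕ L * (fromℕ L ^ k * β)           ≡⟨ sym (ℚₚ.*-assoc (fromℕ L) _ β) ⟩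
  fromℕ L ^ suc k * β                   ∎
  where
  open ℚₚ.≤-Reasoning
  each : ∀ x → x ∈ xs → ∑ (map (x ∷_) (tuples k xs)) f ≤ fromℕ L ^ k * β
  each x _ = ℚₚ.≤-trans (ℚₚ.≤-reflexive (∑-map (x ∷_) (tuples k xs) f)) (∑-tuples-≤ k xs |xs|≤L β≥0 (λ v → f≤β (x ∷ v)))

support : Config → List ℕ
support M = nonOne (a M ∷ b M ∷ c M ∷ d' M ∷ e M ∷ f M ∷ x M ∷ y M ∷ z M ∷ u M ∷ v M ∷ w M ∷ [])

lowerEntries : Config → List ℕ
lowerEntries M = nonOne (x M ∷ y M ∷ z M ∷ u M ∷ v M ∷ w M ∷ [])

-- The footprint only records entries in [1, n]; the range condition makes it record the whole
-- support, so that its size is at least effSize M.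
Admissible : ℕ → ℕ → Config → Set
Admissible n r M = 9 ℕ.≤ effSize M ℕ.+ r × All (_∈ oneTo n) (support M)

admissible? : ∀ n r M → Dec (Admissible n r M)
admissible? n r M = (9 ℕ.≤? effSize M ℕ.+ r) ×-dec All.all? (_∈? oneTo n) (support M)

hit : (n : ℕ) → ℕ × Config → Subset n → ℚ
hit n (r , M) S = 𝟙 (admissible? n r M) * 𝟙 (footprint n (support M) ⊆? S)

hit-nonNeg : ∀ n e S → 0ℚ ≤ hit n e S
hit-nonNeg n (r , M) S = *-nonNeg (𝟙-nonNeg (admissible? n r M)) (𝟙-nonNeg (footprint n (support M) ⊆? S))

𝔼-hit≤ : ∀ {n p} → 0ℚ ≤ p → p ≤ 1ℚ → ∀ r M → 𝔼 n p (hit n (r , M)) ≤ p ^ (9 ℕ.∸ r)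
𝔼-hit≤ {n} {p} p≥0 p≤1 r M =
  ℚₚ.≤-trans (ℚₚ.≤-reflexive (𝔼-*ˡ n p (𝟙 (admissible? n r M)) (λ S → 𝟙 (fp ⊆? S)))) (bound (admissible? n r M))
  where
  open ℚₚ.≤-Reasoning
  fp : Subset n
  fp = footprint n (support M)
  bound : (adm? : Dec (Admissible n r M)) → 𝟙 adm? * 𝔼 n p (λ S → 𝟙 (fp ⊆? S)) ≤ p ^ (9 ℕ.∸ r)
  bound (no _) = begin
    0ℚ * 𝔼 n p (λ S → 𝟙 (fp ⊆? S)) ≡⟨ ℚₚ.*-zeroˡ (𝔼 n p (λ S → 𝟙 (fp ⊆? S))) ⟩
    0ℚ                              ≤⟨ ^-nonNeg (9 ℕ.∸ r) p≥0 ⟩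
    p ^ (9 ℕ.∸ r)                   ∎
  bound (yes (9≤s+r , support⊆)) = begin
    1ℚ * 𝔼 n p (λ S → 𝟙 (fp ⊆? S)) ≡⟨ ℚₚ.*-identityˡ (𝔼 n p (λ S → 𝟙 (fp ⊆? S))) ⟩
    𝔼 n p (λ S → 𝟙 (fp ⊆? S))       ≡⟨ 𝔼-𝟙-⊆ p fp ⟩
    p ^ ∣ fp ∣                      ≤⟨ ^-antimonoʳ-≤ p≥0 p≤1 (ℕₚ.≤-trans 9∸r≤s s≤∣fp∣) ⟩
    p ^ (9 ℕ.∸ r)                   ∎
    where
    9∸r≤s : 9 ℕ.∸ r ℕ.≤ effSize M
    9∸r≤s = subst (9 ℕ.∸ r ℕ.≤_) (ℕₚ.m+n∸n≡m (effSize M) r) (ℕₚ.∸-monoˡ-≤ r 9≤s+r)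
    s≤∣fp∣ : effSize M ℕ.≤ ∣ fp ∣
    s≤∣fp∣ = length-deduplicate≤∣footprint∣ (All.lookup support⊆)

top : Vec ℕ 6 → ℕ
top (x ∷ y ∷ z ∷ u ∷ v ∷ w ∷ []) = (x ℕ.* y ℕ.* z) ℕ.* (u ℕ.* v ℕ.* w)

configOf : Vec ℕ 6 → Vec ℕ 3 → Config
configOf xyzuvw@(x ∷ y ∷ z ∷ u ∷ v ∷ w ∷ []) (d ∷ e ∷ f ∷ []) =
  config (x ℕ.* y ℕ.* z) (u ℕ.* v ℕ.* w) (top xyzuvw) d e f x y z u v w

completions : ℕ → Vec ℕ 6 → List Config
completions n xyzuvw = map (configOf xyzuvw) (tuples 3 (boundedDivisors n (top xyzuvw)))

configsOver : ℕ → ℕ → List Config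
configsOver n P = concatMap (completions n) (tuples 6 (boundedDivisors n P))

SmallProduct : ℕ → ℕ → ℕ → Set
SmallProduct n r P = P ℕ.^ 9 ℕ.* n ℕ.^ r ℕ.≤ n ℕ.^ 9

smallProduct? : ∀ n r → Decidable (SmallProduct n r)
smallProduct? n r P = P ℕ.^ 9 ℕ.* n ℕ.^ r ℕ.≤? n ℕ.^ 9

maxProduct : ℕ → ℕ → ℕ
maxProduct n r = greatest (smallProduct? n r) n

candidatesAt : ℕ → ℕ → List (ℕ × Config)
candidatesAt n r = map (r ,_) (concatMap (configsOver n) (oneTo (maxProduct n r)))

-- A configuration has at most six lower entries, so its repetition number is below 7.
candidates : ℕ → List (ℕ × Config)
candidates n = concatMap (candidatesAt n) (upTo 7)

∑-configsOver≤ : ∀ {n p} → 0ℚ ≤ p → p ≤ 1ℚ → ∀ r P →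
  ∑ (configsOver n P) (λ M → 𝔼 n p (hit n (r , M))) ≤ fromℕ (D n) ^ 9 * p ^ (9 ℕ.∸ r)
∑-configsOver≤ {n} {p} p≥0 p≤1 r P = begin
  ∑ (configsOver n P) F
    ≡⟨ ∑-concatMap (completions n) (tuples 6 (boundedDivisors n P)) F ⟩
  ∑ (tuples 6 (boundedDivisors n P)) (λ xs → ∑ (completions n xs) F)
    ≤⟨ ∑-tuples-≤ 6 (boundedDivisors n P) (length-boundedDivisors≤D n P)
                  (*-nonNeg (^-nonNeg 3 (fromℕ-nonNeg (D n))) β≥0) completions≤ ⟩
  fromℕ (D n) ^ 6 * (fromℕ (D n) ^ 3 * β)
    ≡⟨ trans (sym (ℚₚ.*-assoc (fromℕ (D n) ^ 6) _ β)) (cong (_* β) (sym (^-homo-* (fromℕ (D n)) 6 3))) ⟩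
  fromℕ (D n) ^ 9 * β ∎
  where
  open ℚₚ.≤-Reasoning
  β : ℚ
  β = p ^ (9 ℕ.∸ r)
  β≥0 : 0ℚ ≤ β
  β≥0 = ^-nonNeg (9 ℕ.∸ r) p≥0
  F : Config → ℚ
  F M = 𝔼 n p (hit n (r , M))
  completions≤ : ∀ xs → ∑ (completions n xs) F ≤ fromℕ (D n) ^ 3 * β
  completions≤ xs = ℚₚ.≤-trans (ℚₚ.≤-reflexive (∑-map (configOf xs) (tuples 3 (boundedDivisors n (top xs))) F))
    (∑-tuples-≤ 3 (boundedDivisors n (top xs)) (length-boundedDivisors≤D n (top xs)) β≥0
                (λ ds → 𝔼-hit≤ {n} p≥0 p≤1 r (configOf xs ds)))

∑-candidates≤ : ∀ {n p δ} → 0ℚ ≤ p → p ≤ 1ℚ → 0ℚ ≤ δ →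
  (∀ r → r ℕ.< 7 → fromℕ (maxProduct n r) * (fromℕ (D n) ^ 9 * p ^ (9 ℕ.∸ r)) ≤ δ) →
  ∑ (candidates n) (λ e → 𝔼 n p (hit n e)) ≤ fromℕ 7 * δ
∑-candidates≤ {n} {p} {δ} p≥0 p≤1 δ≥0 mass≤δ =
  ∑-concatMap-≤ (candidatesAt n) {f = λ e → 𝔼 n p (hit n e)} (ℕₚ.≤-reflexive (Listₚ.length-upTo 7)) δ≥0 λ r r∈ → begin
    ∑ (map (r ,_) (concatMap (configsOver n) (oneTo (maxProduct n r)))) (λ e → 𝔼 n p (hit n e))
      ≡⟨ ∑-map (r ,_) (concatMap (configsOver n) (oneTo (maxProduct n r))) (λ e → 𝔼 n p (hit n e)) ⟩
    ∑ (concatMap (configsOver n) (oneTo (maxProduct n r))) (λ M → 𝔼 n p (hit n (r , M)))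
      ≤⟨ ∑-concatMap-≤ (configsOver n) {xs = oneTo (maxProduct n r)} (ℕₚ.≤-reflexive (length-oneTo (maxProduct n r)))
           (*-nonNeg (^-nonNeg 9 (fromℕ-nonNeg (D n))) (^-nonNeg (9 ℕ.∸ r) p≥0))
           (λ P _ → ∑-configsOver≤ p≥0 p≤1 r P) ⟩
    fromℕ (maxProduct n r) * (fromℕ (D n) ^ 9 * p ^ (9 ℕ.∸ r))
      ≤⟨ mass≤δ r (∈ₚ.∈-upTo⁻ r∈) ⟩
    δ ∎
  where open ℚₚ.≤-Reasoning

∈T⇒∈oneTo : ∀ {n t} {S : Subset n} → t ∈T S → t ∈ oneTo n
∈T⇒∈oneTo ((i , refl , _) , _) = ∈-oneTo (ℕ.s≤s ℕ.z≤n) (Finₚ.toℕ<n i)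

∈T⇒1≤ : ∀ {n t} {S : Subset n} → t ∈T S → 1 ℕ.≤ t
∈T⇒1≤ ((i , refl , _) , _) = ℕ.s≤s ℕ.z≤n

∈T⇒≤n : ∀ {n t} {S : Subset n} → t ∈T S → t ℕ.≤ n
∈T⇒≤n ((i , refl , _) , _) = Finₚ.toℕ<n i

∈-nonOne⁻ : ∀ {n t xs} {S : Subset n} → All (_∈T₁ S) xs → t ∈ nonOne xs → t ∈T S
∈-nonOne⁻ xs∈ t∈ with ∈ₚ.∈-filter⁻ (λ t → ¬? (t ℕ.≟ 1)) t∈
... | t∈xs , t≢1 = [ (λ t∈T → t∈T) , (λ t≡1 → contradiction t≡1 t≢1) ]′ (All.lookup xs∈ t∈xs)

product-nonOne : ∀ xs → product (nonOne xs) ≡ product xs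
product-nonOne []       = refl
product-nonOne (t ∷ xs) with t ℕ.≟ 1
... | yes refl = begin-equality
  product (nonOne (1 ∷ xs))  ≡⟨ cong product (Listₚ.filter-reject (λ t → ¬? (t ℕ.≟ 1)) {xs = xs} (λ 1≢1 → 1≢1 refl)) ⟩
  product (nonOne xs)        ≡⟨ product-nonOne xs ⟩
  product xs                 ≡⟨ sym (ℕₚ.+-identityʳ _) ⟩
  1 ℕ.* product xs           ∎
  where open ℕₚ.≤-Reasoning
... | no t≢1 = begin-equality
  product (nonOne (t ∷ xs))  ≡⟨ cong product (Listₚ.filter-accept (λ t → ¬? (t ℕ.≟ 1)) {xs = xs} t≢1) ⟩
  t ℕ.* product (nonOne xs)  ≡⟨ cong (t ℕ.*_) (product-nonOne xs) ⟩
  t ℕ.* product xs           ∎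
  where open ℕₚ.≤-Reasoning

module Forbidden {n} {S : Subset n} {M : Config} (forbidden : IsForbidden S M) where
  open IsForbidden forbidden

  support-∈T : ∀ {t} → t ∈ support M → t ∈T S
  support-∈T = ∈-nonOne⁻ {S = S}
    (inj₁ a∈ ∷ inj₁ b∈ ∷ inj₁ c∈ ∷ inj₁ d∈ ∷ inj₁ e∈ ∷ f∈ ∷ inj₁ x∈ ∷ inj₁ y∈ ∷ z∈ ∷ inj₁ u∈ ∷ inj₁ v∈ ∷ w∈ ∷ [])

  lowerEntries-∈T : ∀ {t} → t ∈ lowerEntries M → t ∈T S
  lowerEntries-∈T = ∈-nonOne⁻ {S = S} (inj₁ x∈ ∷ inj₁ y∈ ∷ z∈ ∷ inj₁ u∈ ∷ inj₁ v∈ ∷ w∈ ∷ [])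

  hit≡1 : 9 ℕ.≤ effSize M ℕ.+ repNum M → hit n (repNum M , M) S ≡ 1ℚ
  hit≡1 big = cong₂ _*_
    (𝟙-yes (admissible? n (repNum M) M) (big , All.tabulate (∈T⇒∈oneTo {S = S} ∘ support-∈T)))
    (𝟙-yes (footprint n (support M) ⊆? S) (footprint-⊆ {S = S} (proj₁ ∘ support-∈T)))

  private
    lower : Vec ℕ 6
    lower = x M ∷ y M ∷ z M ∷ u M ∷ v M ∷ w M ∷ []

    upper : Vec ℕ 3
    upper = d' M ∷ e M ∷ f M ∷ []

    distinctLower : List ℕ
    distinctLower = deduplicate ℕ._≟_ (lowerEntries M)

    P : ℕ
    P = product distinctLower

    top≡c : top lower ≡ c M
    top≡c = sym (trans c≡ab (cong₂ ℕ._*_ a≡xyz b≡uvw))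

    product-lowerEntries : product (lowerEntries M) ≡ c M
    product-lowerEntries = begin-equality
      product (lowerEntries M)
        ≡⟨ product-nonOne (Vec.toList lower) ⟩
      product (Vec.toList lower)
        ≡⟨ solve 6 (λ x y z u v w → x :* (y :* (z :* (u :* (v :* (w :* con 1))))) := (x :* y :* z) :* (u :* v :* w))
                   refl (x M) (y M) (z M) (u M) (v M) (w M) ⟩
      top lower
        ≡⟨ top≡c ⟩
      c M ∎
      where open ℕₚ.≤-Reasoning
            open ℕSolver.+-*-Solver

    1≤c : 1 ℕ.≤ c M
    1≤c = ∈T⇒1≤ {S = S} c∈

    c≤n : c M ℕ.≤ n
    c≤n = ∈T⇒≤n {S = S} c∈

    distinctLower-unique : Unique distinctLower
    distinctLower-unique = deduplicate-! ℕ._≟_ (lowerEntries M)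

    distinctLower⊆ : distinctLower ⊆ lowerEntries M
    distinctLower⊆ = ∈ₚ.∈-deduplicate⁻ ℕ._≟_ (lowerEntries M)

    1≤P : 1 ℕ.≤ P
    1≤P = ℕ.>-nonZero⁻¹ P
      {{product≢0 (All.tabulate (λ t∈ → ℕ.>-nonZero (∈T⇒1≤ {S = S} (lowerEntries-∈T (distinctLower⊆ t∈)))))}}

    P∣c : P ∣ c M
    P∣c = subst (P ∣_) product-lowerEntries (Unique-⊆⇒product∣ distinctLower-unique distinctLower⊆)

    P≤n : P ℕ.≤ n
    P≤n = ℕₚ.≤-trans (Div.∣⇒≤ {{ℕ.>-nonZero 1≤c}} P∣c) c≤n

    P-small : SmallProduct n (repNum M) P
    P-small = begin
      P ℕ.^ 9 ℕ.* n ℕ.^ repNum M        ≤⟨ Unique-⊆⇒product^-bound distinctLower-unique distinctLower⊆ {9} {n}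
                                             (All.tabulate (λ t∈ → ℕₚ.<⇒≤ (proj₂ (lowerEntries-∈T t∈)))) ⟩
      product (lowerEntries M) ℕ.^ 9    ≡⟨ cong (ℕ._^ 9) product-lowerEntries ⟩
      c M ℕ.^ 9                         ≤⟨ ℕₚ.^-monoˡ-≤ 9 c≤n ⟩
      n ℕ.^ 9                           ∎
      where open ℕₚ.≤-Reasoning

    repNum<7 : repNum M ℕ.< 7
    repNum<7 = ℕ.s≤s (ℕₚ.≤-trans (ℕₚ.m∸n≤m _ (length distinctLower))
                                 (Listₚ.length-filter (λ t → ¬? (t ℕ.≟ 1)) (Vec.toList lower)))

    lower-∣P : Vec.toList lower ⊆ boundedDivisors n P
    lower-∣P {t} t∈ with t ℕ.≟ 1
    ... | yes refl = ∈-boundedDivisors (Div.1∣ P) 1≤P P≤n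
    ... | no  t≢1  = ∈-boundedDivisors
      (∈⇒∣product (∈ₚ.∈-deduplicate⁺ ℕ._≟_ (∈ₚ.∈-filter⁺ (λ t → ¬? (t ℕ.≟ 1)) t∈ t≢1))) 1≤P P≤n

    upper-∣c : Vec.toList upper ⊆ boundedDivisors n (top lower)
    upper-∣c {t} t∈ = subst (λ m → t ∈ boundedDivisors n m) (sym top≡c)
                            (∈-boundedDivisors (subst (t ∣_) (sym c≡def) (∣def t∈)) 1≤c c≤n)
      where
      ∣def : ∀ {t} → t ∈ Vec.toList upper → t ∣ d' M ℕ.* e M ℕ.* f M
      ∣def (here refl)                 = Div.∣-trans (Div.m∣m*n (e M)) (Div.m∣m*n (f M))
      ∣def (there (here refl))         = Div.∣-trans (Div.n∣m*n (d' M)) (Div.m∣m*n (f M))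
      ∣def (there (there (here refl))) = Div.n∣m*n (d' M ℕ.* e M)

    configOf≡M : configOf lower upper ≡ M
    configOf≡M = trans
      (cong₂ (λ A B → config A B (A ℕ.* B) (d' M) (e M) (f M) (x M) (y M) (z M) (u M) (v M) (w M)) (sym a≡xyz) (sym b≡uvw))
      (cong (λ C → config (a M) (b M) C (d' M) (e M) (f M) (x M) (y M) (z M) (u M) (v M) (w M)) (sym c≡ab))

  ∈-candidates : (repNum M , M) ∈ candidates n
  ∈-candidates = ∈ₚ.∈-concatMap⁺ (candidatesAt n) (lose (∈ₚ.∈-upTo⁺ repNum<7) (∈ₚ.∈-map⁺ (repNum M ,_) M∈))
    where
    P∈ : P ∈ oneTo (maxProduct n (repNum M))
    P∈ = ∈-oneTo 1≤P (greatest-maximal (smallProduct? n (repNum M)) n P-small P≤n)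
    M∈completions : M ∈ completions n lower
    M∈completions = subst (_∈ completions n lower) configOf≡M (∈ₚ.∈-map⁺ (configOf lower) (∈-tuples upper-∣c))
    M∈configsOver : M ∈ configsOver n P
    M∈configsOver = ∈ₚ.∈-concatMap⁺ (completions n) (lose (∈-tuples lower-∣P) M∈completions)
    M∈ : M ∈ concatMap (configsOver n) (oneTo (maxProduct n (repNum M)))
    M∈ = ∈ₚ.∈-concatMap⁺ (configsOver n) (lose P∈ M∈configsOver)

small-product-mass≤1 : ∀ {m n X r} {q : ℚ} → 1 ℕ.≤ n → r ℕ.≤ suc m →
  X ℕ.^ suc m ℕ.* n ℕ.^ r ℕ.≤ n ℕ.^ suc m → 0ℚ ≤ q → fromℕ n * q ^ suc m ≤ 1ℚ →
  fromℕ X * q ^ (suc m ℕ.∸ r) ≤ 1ℚ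
small-product-mass≤1 {m} {n} {X} {r} {q} 1≤n r≤M small q≥0 nq^M≤1 =
  ^-≤1⇒≤1 m (*-nonNeg (fromℕ-nonNeg X) (^-nonNeg k q≥0)) (begin
    (fromℕ X * q ^ k) ^ M          ≡⟨ ^-distrib-* (fromℕ X) (q ^ k) M ⟩
    fromℕ X ^ M * (q ^ k) ^ M      ≡⟨ cong₂ _*_ (sym (fromℕ-^ X M)) exchange ⟩
    fromℕ (X ℕ.^ M) * (q ^ M) ^ k  ≤⟨ *-monoʳ-≤ (^-nonNeg k (^-nonNeg M q≥0)) (fromℕ-mono-≤ X^M≤n^k) ⟩
    fromℕ (n ℕ.^ k) * (q ^ M) ^ k  ≡⟨ cong (_* (q ^ M) ^ k) (fromℕ-^ n k) ⟩
    fromℕ n ^ k * (q ^ M) ^ k      ≡⟨ sym (^-distrib-* (fromℕ n) (q ^ M) k) ⟩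
    (fromℕ n * q ^ M) ^ k          ≤⟨ ^-≤1 k (*-nonNeg (fromℕ-nonNeg n) (^-nonNeg M q≥0)) nq^M≤1 ⟩
    1ℚ                             ∎)
  where
  open ℚₚ.≤-Reasoning
  M k : ℕ
  M = suc m
  k = M ℕ.∸ r
  exchange : (q ^ k) ^ M ≡ (q ^ M) ^ k
  exchange = trans (^-assocʳ q k M) (trans (cong (q ^_) (ℕₚ.*-comm k M)) (sym (^-assocʳ q M k)))
  n^M≡n^k*n^r : n ℕ.^ M ≡ n ℕ.^ k ℕ.* n ℕ.^ r
  n^M≡n^k*n^r = trans (cong (n ℕ.^_) (sym (ℕₚ.m∸n+n≡m r≤M))) (ℕₚ.^-distribˡ-+-* n k r)
  X^M≤n^k : X ℕ.^ M ℕ.≤ n ℕ.^ k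
  X^M≤n^k = ℕₚ.*-cancelʳ-≤ (X ℕ.^ M) (n ℕ.^ k) (n ℕ.^ r) {{ℕₚ.m^n≢0 n r {{ℕ.>-nonZero 1≤n}}}}
              (subst (X ℕ.^ M ℕ.* n ℕ.^ r ℕ.≤_) n^M≡n^k*n^r small)

candidate-mass≤δ : ∀ {n X r Dₙ} {p δ : ℚ} → 1 ℕ.≤ n → 1 ℕ.≤ Dₙ → r ℕ.< 9 → SmallProduct n r X → 0ℚ ≤ p →
  fromℕ n * (p * fromℕ Dₙ ^ 100) ^ 9 ≤ 1ℚ → 0ℚ ≤ δ → 1ℚ ≤ δ * fromℕ Dₙ →
  fromℕ X * (fromℕ Dₙ ^ 9 * p ^ (9 ℕ.∸ r)) ≤ δ
candidate-mass≤δ {n} {X} {r} {Dₙ} {p} {δ} 1≤n 1≤Dₙ r<9 small p≥0 prob δ≥0 1≤δDₙ = begin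
  fromℕ X * (𝐃 ^ 9 * p ^ k)
    ≤⟨ *-monoˡ-≤ (fromℕ-nonNeg X) (*-monoʳ-≤ (^-nonNeg k p≥0) 𝐃^9≤δωℚ^k) ⟩
  fromℕ X * ((δ * ωℚ ^ k) * p ^ k)
    ≡⟨ solve 4 (λ X δ W P → X :* ((δ :* W) :* P) := δ :* (X :* (P :* W))) refl (fromℕ X) δ (ωℚ ^ k) (p ^ k) ⟩
  δ * (fromℕ X * (p ^ k * ωℚ ^ k))
    ≡⟨ cong (λ t → δ * (fromℕ X * t)) (sym (^-distrib-* p ωℚ k)) ⟩
  δ * (fromℕ X * (p * ωℚ) ^ k)
    ≤⟨ *-monoˡ-≤ δ≥0 (small-product-mass≤1 {8} {n} {X} 1≤n (ℕₚ.<⇒≤ r<9) small (*-nonNeg p≥0 ωℚ≥0) prob) ⟩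
  δ * 1ℚ
    ≡⟨ ℚₚ.*-identityʳ δ ⟩
  δ ∎
  where
  open ℚₚ.≤-Reasoning
  open +-*-Solver
  k : ℕ
  k = 9 ℕ.∸ r
  𝐃 ωℚ : ℚ
  𝐃 = fromℕ Dₙ
  ωℚ = 𝐃 ^ 100
  𝐃≥1 : 1ℚ ≤ 𝐃
  𝐃≥1 = fromℕ-mono-≤ 1≤Dₙ
  ωℚ≥1 : 1ℚ ≤ ωℚ
  ωℚ≥1 = 1≤^ 100 𝐃≥1
  ωℚ≥0 : 0ℚ ≤ ωℚ
  ωℚ≥0 = ℚₚ.≤-trans 0≤1 ωℚ≥1
  𝐃^9≤δωℚ^k : 𝐃 ^ 9 ≤ δ * ωℚ ^ k
  𝐃^9≤δωℚ^k = begin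
    𝐃 ^ 9            ≡⟨ sym (ℚₚ.*-identityʳ _) ⟩
    𝐃 ^ 9 * 1ℚ       ≤⟨ *-monoˡ-≤ (^-nonNeg 9 (fromℕ-nonNeg Dₙ)) 1≤δDₙ ⟩
    𝐃 ^ 9 * (δ * 𝐃)  ≡⟨ solve 3 (λ A δ B → A :* (δ :* B) := δ :* (B :* A)) refl (𝐃 ^ 9) δ 𝐃 ⟩
    δ * 𝐃 ^ 10       ≤⟨ *-monoˡ-≤ δ≥0 (^-monoʳ-≤ 𝐃≥1 (ℕₚ.m≤m+n 10 90)) ⟩
    δ * ωℚ           ≡⟨ cong (δ *_) (sym (ℚₚ.*-identityʳ ωℚ)) ⟩
    δ * ωℚ ^ 1       ≤⟨ *-monoˡ-≤ δ≥0 (^-monoʳ-≤ ωℚ≥1 (ℕₚ.m<n⇒0<n∸m r<9)) ⟩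
    δ * ωℚ ^ k       ∎

^ℚ≡^ : ∀ q k → q ^ℚ k ≡ q ^ k
^ℚ≡^ q zero    = refl
^ℚ≡^ q (suc k) = cong (q *_) (^ℚ≡^ q k)

ProbBound⇒n[pω]^9≤1 : ∀ {n p} → ProbBound n p → fromℕ n * (p * fromℕ (D n) ^ 100) ^ 9 ≤ 1ℚ
ProbBound⇒n[pω]^9≤1 {n} {p} (_ , bound) =
  subst (λ t → fromℕ n * t ≤ 1ℚ)
        (trans (^ℚ≡^ (p * fromℕ (ω n)) 9) (cong (λ W → (p * W) ^ 9) (fromℕ-^ (D n) 100))) bound

ProbBound⇒≤1 : ∀ {n p} → 1 ℕ.≤ n → ProbBound n p → p ≤ 1ℚ
ProbBound⇒≤1 {n} {p} 1≤n pb@(p≥0 , _) = ^-≤1⇒≤1 8 p≥0 (begin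
  p ^ 9                          ≡⟨ sym (ℚₚ.*-identityʳ _) ⟩
  p ^ 9 * 1ℚ                     ≤⟨ *-monoˡ-≤ (^-nonNeg 9 p≥0) (1≤^ 9 ωℚ≥1) ⟩
  p ^ 9 * ωℚ ^ 9                 ≡⟨ sym (^-distrib-* p ωℚ 9) ⟩
  (p * ωℚ) ^ 9                   ≡⟨ sym (ℚₚ.*-identityˡ _) ⟩
  1ℚ * (p * ωℚ) ^ 9              ≤⟨ *-monoʳ-≤ (^-nonNeg 9 (*-nonNeg p≥0 (ℚₚ.≤-trans 0≤1 ωℚ≥1))) (fromℕ-mono-≤ 1≤n) ⟩
  fromℕ n * (p * ωℚ) ^ 9         ≤⟨ ProbBound⇒n[pω]^9≤1 {n} pb ⟩
  1ℚ                             ∎)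
  where
  open ℚₚ.≤-Reasoning
  ωℚ : ℚ
  ωℚ = fromℕ (D n) ^ 100
  ωℚ≥1 : 1ℚ ≤ ωℚ
  ωℚ≥1 = 1≤^ 100 (fromℕ-mono-≤ (D-unbounded {0} 1≤n))

archimedean : ∀ q → 0ℚ < q → ∃ λ K → 1ℚ ≤ q * fromℕ K
archimedean q@(mkℚ (ℤ.+ suc a) b _) _ = suc b , subst (λ B → 1ℚ ≤ q * B) (sym (fromℕ≡nf (suc b)))
  (ℚₚ.toℚᵘ-cancel-≤ (ℚᵘₚ.≤-respʳ-≃ (ℚᵘₚ.≃-sym (ℚₚ.toℚᵘ-homo-* q (fromℕ-nf (suc b))))
                                    (ℚᵘ.*≤* (ℤ.+≤+ (ℕ.s≤s b≤)))))
  where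
  -- 1 ≤ q · (1 + b) = (1 + a)(1 + b) / (1 + b), cross-multiplied and in normal form.
  b≤ : b ℕ.* 1 ℕ.+ 0 ℕ.* suc (b ℕ.* 1) ℕ.≤ (b ℕ.+ a ℕ.* suc b) ℕ.* 1
  b≤ rewrite ℕₚ.*-identityʳ b | ℕₚ.*-identityʳ (b ℕ.+ a ℕ.* suc b) | ℕₚ.+-identityʳ b = ℕₚ.m≤m+n b _
archimedean (mkℚ (ℤ.+ zero) b _) (ℚ.*<* (ℤ.+<+ ()))
archimedean (mkℚ ℤ.-[1+ a ] b _) (ℚ.*<* ())

forbidden⇒1≤∑hit : ∀ {n} {S : Subset n} → (Σ Config λ M → IsForbidden S M × (9 ℕ.≤ effSize M ℕ.+ repNum M)) →
                   1ℚ ≤ ∑ (candidates n) (λ e → hit n e S)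
forbidden⇒1≤∑hit {n} {S} (M , forbidden , big) =
  ℚₚ.≤-trans (ℚₚ.≤-reflexive (sym (Forbidden.hit≡1 forbidden big)))
             (term≤∑ (λ e → hit-nonNeg n e S) (Forbidden.∈-candidates forbidden))

p≤q+r⇒p-r≤q : ∀ {p q r} → p ≤ q + r → p - r ≤ q
p≤q+r⇒p-r≤q {p} {q} {r} p≤q+r = ℚₚ.≤-trans (ℚₚ.+-monoˡ-≤ (- r) p≤q+r)
  (ℚₚ.≤-reflexive (solve 2 (λ q r → (q :+ r) :- r := q) refl q r))
  where open +-*-Solver

D-eventually-large : ∀ δ → 0ℚ < δ → ∃ λ K → ∀ {n} → 2 ℕ.^ K ℕ.≤ n → 1ℚ ≤ δ * fromℕ (D n)
D-eventually-large δ δ>0 with archimedean δ δ>0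
... | K , 1≤δK = K , λ 2^K≤n → ℚₚ.≤-trans 1≤δK
  (*-monoˡ-≤ (ℚₚ.<⇒≤ δ>0) (fromℕ-mono-≤ (ℕₚ.≤-trans (ℕₚ.n≤1+n K) (D-unbounded 2^K≤n))))

Pr[NoBadConfig]≥1-7δ : ∀ {n p δ} → 1 ℕ.≤ n → ProbBound n p → 0ℚ ≤ δ → 1ℚ ≤ δ * fromℕ (D n) →
  (dec : Decidable (NoBadConfig n)) → 1ℚ - fromℕ 7 * δ ≤ Pr n p (NoBadConfig n) dec
Pr[NoBadConfig]≥1-7δ {n} {p} {δ} 1≤n pb@(p≥0 , _) δ≥0 1≤δD dec = p≤q+r⇒p-r≤q (begin
  1ℚ
    ≤⟨ union-bound p≥0 p≤1 dec (candidates n) (hit n) (hit-nonNeg n) covers ⟩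
  Pr n p (NoBadConfig n) dec + ∑ (candidates n) (λ e → 𝔼 n p (hit n e))
    ≤⟨ ℚₚ.+-monoʳ-≤ (Pr n p (NoBadConfig n) dec) (∑-candidates≤ {n} p≥0 p≤1 δ≥0 mass≤δ) ⟩
  Pr n p (NoBadConfig n) dec + fromℕ 7 * δ ∎)
  where
  open ℚₚ.≤-Reasoning
  p≤1 : p ≤ 1ℚ
  p≤1 = ProbBound⇒≤1 1≤n pb
  covers : ∀ S → ¬ NoBadConfig n S → 1ℚ ≤ ∑ (candidates n) (λ e → hit n e S)
  covers S bad = decidable-stable (1ℚ ≤? ∑ (candidates n) (λ e → hit n e S)) (λ 1≰ → bad (1≰ ∘ forbidden⇒1≤∑hit))
  mass≤δ : ∀ r → r ℕ.< 7 → fromℕ (maxProduct n r) * (fromℕ (D n) ^ 9 * p ^ (9 ℕ.∸ r)) ≤ δ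
  mass≤δ r r<7 = candidate-mass≤δ {n} {maxProduct n r} {r} 1≤n (D-unbounded {0} 1≤n)
    (ℕₚ.<-≤-trans r<7 (ℕₚ.m≤m+n 7 2)) (greatest-satisfies (smallProduct? n r) ℕ.z≤n n) p≥0 (ProbBound⇒n[pω]^9≤1 {n} pb) δ≥0 1≤δD

corollary2p8 : (p : ℕ → ℚ) → (∀ n → ProbBound n (p n))
    → (dec : ∀ n → Decidable (NoBadConfig n))
    → ∀ (ε : ℚ) → 0ℚ < ε
    → Σ ℕ λ N → ∀ n → n ≥ N → (1ℚ - ε) ≤ Pr n (p n) (NoBadConfig n) (dec n)
corollary2p8 p bound dec ε ε>0 = 2 ℕ.^ K , λ n 2^K≤n →
  subst (λ t → 1ℚ - t ≤ Pr n (p n) (NoBadConfig n) (dec n)) 7δ≡ε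
    (Pr[NoBadConfig]≥1-7δ (ℕₚ.≤-trans (ℕₚ.m^n>0 2 K) 2^K≤n) (bound n) (ℚₚ.<⇒≤ δ>0) (δD≥1 2^K≤n) (dec n))
  where
  δ : ℚ
  δ = ε * (ℤ.+ 1 / 7)
  δ>0 : 0ℚ < δ
  δ>0 = ℚₚ.positive⁻¹ δ {{ℚₚ.pos*pos⇒pos ε {{ℚ.positive ε>0}} (ℤ.+ 1 / 7)}}
  7δ≡ε : fromℕ 7 * δ ≡ ε
  7δ≡ε = trans (solve 2 (λ s e → s :* (e :* con (ℤ.+ 1 / 7)) := e :* (s :* con (ℤ.+ 1 / 7))) refl (fromℕ 7) ε)
               (ℚₚ.*-identityʳ ε)
    where open +-*-Solver
  K : ℕ
  K = proj₁ (D-eventually-large δ δ>0)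
  δD≥1 : ∀ {n} → 2 ℕ.^ K ℕ.≤ n → 1ℚ ≤ δ * fromℕ (D n)
  δD≥1 = proj₂ (D-eventually-large δ δ>0)
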